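{- If SearchLDS is used to locate a key or determine its absence, then the insertion and deletion procedures for a lattice data structure with $N$ proper keys run in time $O(\sqrt{N})$.
   Context: Diagram of height $h$: cells $(r,c)$ of positive integers with $r+c\le h+4$; $r$ is the row (numbered bottom to top), $c$ the column (left to right). Diagonal $k$ ($1\le k\le h+3$) is the set of cells with $r+c=k+1$, numbered from head $(k,1)$ to tail $(1,k)$, its $j$-th cell being $(k+1-j,j)$. A lattice data structure (LDS) of height $h$ assigns to each cell an entry in $\{0,\infty\}\cup\mathbb{Z}_{>0}$ such that: (1) all cells of row $1$ and column $1$ contain $0$; (2) all cells of diagonal $h+3$ except head and tail contain $\infty$; (3) for some $0\le m\le h-1$, exactly the cells $(h+3-j,j)$ of diagonal $h+2$ with $h+2-m\le j\le h+1$ contain $\infty$; (4) all remaining cells contain pairwise distinct positive integers (proper keys); (5) proper keys are strictly increasing along each row (left to right), column (bottom to top) and diagonal (head to tail). Order convention: $0<n<\infty$; cells are compared via their entries. For a cell $C=(r,c)$: $D=(r-1,c)$, $U=(r+1,c)$, $UL=(r+1,c-1)$, $DR=(r-1,c+1)$. SearchLDS($L,K$): start at $(h+1,2)$; repeatedly: entry $=K$ → stop (present); entry $=0$ → stop (absent); else move to $DR$ if $K>$ entry, to $D$ if $K<$ entry. Inward($L,C$): while ($C<D$ or $C<UL$): if $UL>D$ swap entries of $UL$ and $C$, else swap entries of $D$ and $C$; $C$ then denotes the cell holding the moved original entry. Outward($L,C$): while ($C>U$ or ($C>DR$ and $DR\neq0$)): if $DR<U$ and $DR\ne 0$ swap entries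 of $DR$ and $C$, else swap entries of $U$ and $C$; $C$ then denotes the cell holding the moved original entry. Insertion of a positive integer $K$: run SearchLDS; if $K$ is present, stop. Otherwise, if diagonal $h+2$ has a non-boundary cell containing $\infty$, put $K$ into the first such cell (from the head); if not, enlarge the lattice to height $h+1$ (adding diagonal $h+4$ with $0$ at head and tail and $\infty$ elsewhere, so the old diagonal $h+3$ becomes the new diagonal $(h+1)+2$) and put $K$ into the second cell of diagonal $h+3$. Then apply Inward at the cell containing $K$. Deletion of $K$: locate $K$ with SearchLDS (if absent, nothing is done); let $C$ be its cell. If $C$ holds the last proper key of diagonal $h+2$, put $\infty$ into $C$. Otherwise let $F$ be the cell holding the last proper key of diagonal $h+2$, move that key into $C$ and put $\infty$ into $F$; then apply Inward at $C$ if ($C<D$ or $C<UL$), and Outward at $C$ if ($C>U$ or ($C>DR$ and $DR\ne 0$)). In all cases, if diagonal $h+2$ then contains no proper key, reduce the height of the lattice by one. -}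

module Defs where

open import Data.Nat using (ℕ; zero; suc; _+_; _*_; _∸_; _≤_; _<_; _≡ᵇ_; _<ᵇ_)
open import Data.Bool using (Bool; true; false; if_then_else_; _∨_; _∧_; not)
open import Data.Product using (_×_; _,_; ∃-syntax)
open import Data.Maybe using (Maybe; just; nothing)
open import Relation.Binary.PropositionalEquality using (_≡_; _≢_)
open import Relation.Nullary using (¬_)
open import Data.Sum using (_⊎_)

data Entry : Set where
  zer : Entry
  inf : Entry
  key : ℕ → Entry      -- a proper key (a positive integer in a valid LDS)

_<ᴱ_ : Entry → Entry → Bool
zer   <ᴱ zer   = false
zer   <ᴱ inf   = true
zer   <ᴱ key _ = true
inf   <ᴱ _     = false
key _ <ᴱ zer   = false
key _ <ᴱ inf   = true
key m <ᴱ key n = m <ᵇ n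

isZer : Entry → Bool
isZer zer = true
isZer _   = false

isKey : Entry → Bool
isKey (key _) = true
isKey _       = false

isInf : Entry → Bool
isInf inf = true
isInf _   = false

-- Lattices: a height h and an assignment of entries to cells (row, column)
-- (rows and columns numbered from 1; only cells with r + c ≤ h + 4 matter)

Grid : Set
Grid = ℕ → ℕ → Entry

record Lattice : Set where
  constructor mkLattice
  field
    height : ℕ
    entry  : Grid
open Lattice public

InDiagram : ℕ → ℕ → ℕ → Set
InDiagram h r c = (1 ≤ r) × (1 ≤ c) × (r + c ≤ h + 4)

Boundary : ℕ → ℕ → Set
Boundary r c = (r ≡ 1) ⊎ (c ≡ 1)

-- the cells of diagonal h+3 other than head and tail : (h+4-j , j), 2 ≤ j ≤ h+2
InfDiag : ℕ → ℕ → ℕ → Set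
InfDiag h r c = (r + c ≡ h + 4) × (2 ≤ c) × (c ≤ h + 2)

-- the cells (h+3-j , j) of diagonal h+2 with h+2-m ≤ j ≤ h+1
InfTail : ℕ → ℕ → ℕ → ℕ → Set
InfTail h m r c = (r + c ≡ h + 3) × (h + 2 ∸ m ≤ c) × (c ≤ h + 1)


record IsLDS (L : Lattice) : Set where
  private
    h = height L
    E = entry L
  field
    m      : ℕ
    m<h    : m < h
    row1   : ∀ c → InDiagram h 1 c → E 1 c ≡ zer
    col1   : ∀ r → InDiagram h r 1 → E r 1 ≡ zer
    diagInf : ∀ r c → InfDiag h r c → E r c ≡ inf
    tailInf : ∀ r c → InfTail h m r c → E r c ≡ inf
    keys   : ∀ r c → InDiagram h r c → ¬ (Boundary r c) → ¬ (InfDiag h r c) →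
             ¬ (InfTail h m r c) → ∃[ n ] ((E r c ≡ key n) × (0 < n))
    distinct : ∀ r c r' c' n → InDiagram h r c → InDiagram h r' c' →
             E r c ≡ key n → E r' c' ≡ key n → (r ≡ r') × (c ≡ c')
    rowInc : ∀ r c c' a b → InDiagram h r c → InDiagram h r c' → c < c' →
             E r c ≡ key a → E r c' ≡ key b → a < b
    colInc : ∀ r r' c a b → InDiagram h r c → InDiagram h r' c → r < r' →
             E r c ≡ key a → E r' c ≡ key b → a < b
    diagInc : ∀ r c r' c' a b → InDiagram h r c → InDiagram h r' c' →
             r + c ≡ r' + c' → c < c' →
             E r c ≡ key a → E r' c' ≡ key b → a < b

countRow : Grid → ℕ → ℕ → ℕ
countRow E r zero    = 0
countRow E r (suc n) = countRow E r n + (if isKey (E r (suc n)) then 1 else 0)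

countRows : Grid → ℕ → ℕ → ℕ
countRows E h zero    = 0
countRows E h (suc k) = countRows E h k + countRow E (suc k) (h + 4 ∸ suc k)

numKeys : Lattice → ℕ
numKeys L = countRows (entry L) (height L) (height L + 3)

set : Grid → ℕ → ℕ → Entry → Grid
set E r c x r' c' = if (r' ≡ᵇ r) ∧ (c' ≡ᵇ c) then x else E r' c'

swap : Grid → ℕ → ℕ → ℕ → ℕ → Grid
swap E r c r' c' = set (set E r c (E r' c')) r' c' (E r c)

-- Cost model: every loop iteration (cell inspected / swap performed)
-- costs one unit; scanning or creating a diagonal of the diagram of
-- height h costs h + 4 units.  Loops run with a fuel of (h+5)^2
-- iterations, far more than any run on a valid LDS needs; the fuel is
-- only there to make the functions total.

fuel : ℕ → ℕ
fuel h = (h + 5) * (h + 5)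

-- SearchLDS: returns (present? , cell reached , number of cells inspected)
search : ℕ → Grid → ℕ → ℕ → ℕ → Bool × (ℕ × ℕ) × ℕ
search zero    E K r c = false , (r , c) , 0
search (suc f) E K r c with E r c
... | zer   = false , (r , c) , 1
... | inf   = step (search f E K (r ∸ 1) c)
  where step : Bool × (ℕ × ℕ) × ℕ → Bool × (ℕ × ℕ) × ℕ
        step (b , x , n) = b , x , suc n
... | key n with K ≡ᵇ n
...   | true  = true , (r , c) , 1
...   | false = step (if n <ᵇ K then search f E K (r ∸ 1) (suc c)
                               else search f E K (r ∸ 1) c)
  where step : Bool × (ℕ × ℕ) × ℕ → Bool × (ℕ × ℕ) × ℕ
        step (b , x , n) = b , x , suc n

-- Inward: returns (new grid , number of loop tests performed)
inward : ℕ → Grid → ℕ → ℕ → Grid × ℕ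
inward zero    E r c = E , 0
inward (suc f) E r c =
  if (E r c <ᴱ E (r ∸ 1) c) ∨ (E r c <ᴱ E (suc r) (c ∸ 1))
  then (if E (r ∸ 1) c <ᴱ E (suc r) (c ∸ 1)
        then step (inward f (swap E (suc r) (c ∸ 1) r c) (suc r) (c ∸ 1))
        else step (inward f (swap E (r ∸ 1) c r c) (r ∸ 1) c))
  else (E , 1)
  where step : Grid × ℕ → Grid × ℕ
        step (G , n) = G , suc n

-- Outward: returns (new grid , number of loop tests performed)
outward : ℕ → Grid → ℕ → ℕ → Grid × ℕ
outward zero    E r c = E , 0
outward (suc f) E r c =
  if (E (suc r) c <ᴱ E r c) ∨ ((E (r ∸ 1) (suc c) <ᴱ E r c) ∧ not (isZer (E (r ∸ 1) (suc c))))
  then (if (E (r ∸ 1) (suc c) <ᴱ E (suc r) c) ∧ not (isZer (E (r ∸ 1) (suc c)))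
        then step (outward f (swap E (r ∸ 1) (suc c) r c) (r ∸ 1) (suc c))
        else step (outward f (swap E (suc r) c r c) (suc r) c))
  else (E , 1)
  where step : Grid × ℕ → Grid × ℕ
        step (G , n) = G , suc n

-- first j ∈ {2,…,h+1} (from the head) such that cell (h+3-j , j) of
-- diagonal h+2 contains ∞ ; we scan j = 2 + i for i = 0 … k-1
firstInf : Grid → ℕ → ℕ → ℕ → Maybe ℕ
firstInf E h i zero    = nothing
firstInf E h i (suc k) =
  if isInf (E (h + 1 ∸ i) (2 + i)) then just (2 + i) else firstInf E h (suc i) k

-- last j ∈ {2,…,h+1} such that cell (h+3-j , j) holds a proper key;
-- we scan j = 1 + k, k, … , 2
lastKey : Grid → ℕ → ℕ → Maybe ℕ
lastKey E h zero    = nothing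
lastKey E h (suc k) =
  if isKey (E (h + 2 ∸ suc k) (suc (suc k))) then just (suc (suc k)) else lastKey E h k

enlarge : ℕ → Grid → Grid
enlarge h E r c =
  if r + c ≡ᵇ h + 5
  then (if (c ≡ᵇ 1) ∨ (r ≡ᵇ 1) then zer else inf)
  else E r c

insertCost : Lattice → ℕ → ℕ
insertCost L K with search (fuel h) E K (suc h) 2
  where h = height L ; E = entry L
... | true  , _ , s = s
... | false , _ , s with firstInf (entry L) (height L) 0 (height L)
...   | just j  = s + (height L + 4)
                  + Data.Product.proj₂
                      (inward (fuel (height L))
                              (set (entry L) (height L + 3 ∸ j) j (key K))
                              (height L + 3 ∸ j) j)
  where import Data.Product
...   | nothing = s + (height L + 4) + (height L + 5)
                  + Data.Product.proj₂
                      (inward (fuel (suc (height L)))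
                              (set (enlarge (height L) (entry L)) (height L + 2) 2 (key K))
                              (height L + 2) 2)
  where import Data.Product

deleteCost : Lattice → ℕ → ℕ
deleteCost L K with search (fuel h) E K (suc h) 2
  where h = height L ; E = entry L
... | false , _ , s = s
... | true , (r , c) , s with lastKey (entry L) (height L) (height L)
...   | nothing = s + (height L + 4)            -- impossible for a valid LDS
...   | just j with (r ≡ᵇ height L + 3 ∸ j) ∧ (c ≡ᵇ j)
...     | true  = s + (height L + 4) + (height L + 4)
...     | false = s + (height L + 4) + costIn + costOut + (height L + 4)
  where
    h  = height L
    F  = set (set (entry L) r c (entry L (h + 3 ∸ j) j)) (h + 3 ∸ j) j inf
    condIn : Grid → Bool
    condIn G = (G r c <ᴱ G (r ∸ 1) c) ∨ (G r c <ᴱ G (suc r) (c ∸ 1))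
    condOut : Grid → Bool
    condOut G = (G (suc r) c <ᴱ G r c) ∨
                ((G (r ∸ 1) (suc c) <ᴱ G r c) ∧ not (isZer (G (r ∸ 1) (suc c))))
    resIn : Grid × ℕ
    resIn = if condIn F then inward (fuel h) F r c else (F , 1)
    costIn : ℕ
    costIn = Data.Product.proj₂ resIn
    costOut : ℕ
    costOut = if condOut (Data.Product.proj₁ resIn)
              then Data.Product.proj₂ (outward (fuel h) (Data.Product.proj₁ resIn) r c)
              else 1
    import Data.Product

-- SearchLDS descends one row per step, so it inspects at most h + 1 cells.  Inward and
-- Outward move the displaced entry to a neighbouring cell per swap, and r + 2c drops (Inward) or rises
-- (Outward) by one each time.  The walk never leaves the cells with 2 ≤ r, c and r + c ≤ h + 3: it is
-- fenced in by the 0's of row and column 1 and the ∞'s of diagonal h + 3, which the swaps never touch.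
-- So both loops run O(h) times, and with the O(h) diagonal scans insertion and deletion cost at most
-- 7 (h + 4).  Conversely, the ⌊h/2⌋ × ⌊h/2⌋ square of cells with 2 ≤ r, c ≤ ⌊h/2⌋ + 1 lies below
-- diagonal h + 2, hence consists of proper keys: N ≥ ⌊h/2⌋².  Thus cost² = O(h²) = O(N + 1).

module Submission where

open import Defs
open import Data.Bool using (Bool; true; false; T; not; _∧_; _∨_; if_then_else_)
open import Data.Bool.Properties using (∧-zeroʳ; ∨-zeroʳ)
open import Data.Empty using (⊥; ⊥-elim)
open import Data.Maybe using (just; nothing)
open import Data.Nat
open import Data.Nat.Properties
open import Data.Nat.Tactic.RingSolver using (solve-∀)
open import Data.Product using (_×_; _,_; proj₁; proj₂; ∃-syntax)
open import Data.Sum using (_⊎_; inj₁; inj₂)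
open import Relation.Binary.PropositionalEquality
open import Relation.Nullary using (¬_)

x≮ᴱzer : ∀ x → (x <ᴱ zer) ≡ false
x≮ᴱzer zer     = refl
x≮ᴱzer inf     = refl
x≮ᴱzer (key _) = refl

≡ᵇ-false⇒≢ : ∀ m n → (m ≡ᵇ n) ≡ false → m ≢ n
≡ᵇ-false⇒≢ m n eq refl = subst T eq (≡⇒≡ᵇ m m refl)

set-other : ∀ G r c x a b → ¬ (a ≡ r × b ≡ c) → set G r c x a b ≡ G a b
set-other G r c x a b ne with a ≡ᵇ r in eqr | b ≡ᵇ c in eqc
... | false | _     = refl
... | true  | false = refl
... | true  | true  = ⊥-elim (ne (≡ᵇ⇒≡ a r (subst T (sym eqr) _) , ≡ᵇ⇒≡ b c (subst T (sym eqc) _)))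

-- For an LDS of height h, n = h + 3; its ∞ diagonal h + 3 is then r + c = n + 1.
Interior : ℕ → ℕ → ℕ → Set
Interior n r c = (2 ≤ r) × (2 ≤ c) × (r + c ≤ n)

Frozen : ℕ → ℕ → ℕ → Set
Frozen n r c = (r ≡ 1) ⊎ (c ≡ 1) ⊎ (n < r + c)

Interior⇒¬Frozen : ∀ {n r c} → Interior n r c → ¬ Frozen n r c
Interior⇒¬Frozen (s≤s () , _ , _) (inj₁ refl)
Interior⇒¬Frozen (_ , s≤s () , _) (inj₂ (inj₁ refl))
Interior⇒¬Frozen (_ , _ , r+c≤n) (inj₂ (inj₂ n<r+c)) = <⇒≱ n<r+c r+c≤n

AgreeOutside : ℕ → Grid → Grid → Set
AgreeOutside n G G' = ∀ r c → Frozen n r c → G' r c ≡ G r c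

AgreeOutside-refl : ∀ {n G} → AgreeOutside n G G
AgreeOutside-refl _ _ _ = refl

AgreeOutside-trans : ∀ {n G G' G''} → AgreeOutside n G G' → AgreeOutside n G' G'' → AgreeOutside n G G''
AgreeOutside-trans p q r c fr = trans (q r c fr) (p r c fr)

set-interior : ∀ {n r c} G x → Interior n r c → AgreeOutside n G (set G r c x)
set-interior {r = r} {c} G x int a b fr =
  set-other G r c x a b λ { (refl , refl) → Interior⇒¬Frozen int fr }

swap-interior : ∀ {n r c r' c'} G → Interior n r c → Interior n r' c' →
                AgreeOutside n G (swap G r c r' c')
swap-interior {r = r} {c} {r'} {c'} G int int' =
  AgreeOutside-trans (set-interior G _ int) (set-interior (set G r c (G r' c')) _ int')

ZeroBorder : ℕ → Grid → Set
ZeroBorder n G = ∀ k → 1 ≤ k → k ≤ n → (G 1 k ≡ zer) × (G k 1 ≡ zer)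

InfRim : ℕ → Grid → Set
InfRim n G = ∀ r c → 2 ≤ r → 2 ≤ c → r + c ≡ suc n → G r c ≡ inf

ZeroBorder-resp : ∀ {n G G'} → AgreeOutside n G G' → ZeroBorder n G → ZeroBorder n G'
ZeroBorder-resp ag z k 1≤k k≤n =
  trans (ag 1 k (inj₁ refl)) (proj₁ (z k 1≤k k≤n)) ,
  trans (ag k 1 (inj₂ (inj₁ refl))) (proj₂ (z k 1≤k k≤n))

InfRim-resp : ∀ {n G G'} → AgreeOutside n G G' → InfRim n G → InfRim n G'
InfRim-resp ag ir r c 2≤r 2≤c eq = trans (ag r c (inj₂ (inj₂ (≤-reflexive (sym eq))))) (ir r c 2≤r 2≤c eq)

diagonal-step : ∀ r c → r + suc c + suc c ≡ suc (suc r + c + c)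
diagonal-step = solve-∀

6≤potential : ∀ {n r c} → Interior n r c → 6 ≤ r + c + c
6≤potential (2≤r , 2≤c , _) = +-mono-≤ (+-mono-≤ 2≤r 2≤c) 2≤c

inward-blocked-by-zero-left : ∀ d {ul} → ul ≡ zer → (d <ᴱ ul) ≡ true → ⊥
inward-blocked-by-zero-left d refl d<ul with () ← trans (sym d<ul) (x≮ᴱzer d)

inward-blocked-by-zero-below : ∀ x {d ul} → d ≡ zer → (d <ᴱ ul) ≡ false →
                               ((x <ᴱ d) ∨ (x <ᴱ ul)) ≡ true → ⊥
inward-blocked-by-zero-below x {ul = zer} refl _ guard
  with () ← trans (sym guard) (cong₂ _∨_ (x≮ᴱzer x) (x≮ᴱzer x))

InwardBounded : ℕ → Grid → ℕ → ℕ → Grid × ℕ → Set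
InwardBounded n G r c (G' , cost) = (cost + 5 ≤ r + c + c) × AgreeOutside n G G'

inward-swap : ∀ {n G r c r' c' res} → Interior n r c → Interior n r' c' →
              suc (r' + c' + c') ≡ r + c + c →
              InwardBounded n (swap G r' c' r c) r' c' res →
              InwardBounded n G r c (proj₁ res , suc (proj₂ res))
inward-swap {G = G} int int' eq (cost , agree) =
  ≤-trans (s≤s cost) (≤-reflexive eq) , AgreeOutside-trans (swap-interior G int' int) agree

inward-bounded : ∀ n f G r c → Interior n r c → ZeroBorder n G → InwardBounded n G r c (inward f G r c)
inward-bounded n f G 0 c (() , _) z
inward-bounded n f G 1 c (s≤s () , _) z
inward-bounded n f G (suc (suc r)) 0 (_ , () , _) z
inward-bounded n f G (suc (suc r)) 1 (_ , s≤s () , _) z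
inward-bounded n zero G (suc (suc r)) (suc (suc c)) int z =
  ≤-trans (n≤1+n 5) (6≤potential int) , AgreeOutside-refl
inward-bounded n (suc f) G (suc (suc r)) (suc (suc c)) int@(_ , _ , sum≤n) z
  with (G (2 + r) (2 + c) <ᴱ G (suc r) (2 + c)) ∨ (G (2 + r) (2 + c) <ᴱ G (3 + r) (suc c)) in guard
... | false = 6≤potential int , AgreeOutside-refl
... | true with G (suc r) (2 + c) <ᴱ G (3 + r) (suc c) in d<ul
inward-bounded n (suc f) G (suc (suc r)) 2 (_ , _ , sum≤n) z | true | true =
  ⊥-elim (inward-blocked-by-zero-left (G (suc r) 2)
           (proj₂ (z (3 + r) (s≤s z≤n) (≤-trans (n≤1+n _) (subst (_≤ n) (+-comm (2 + r) 2) sum≤n)))) d<ul)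
inward-bounded n (suc f) G (suc (suc r)) (suc (suc (suc c))) int@(_ , _ , sum≤n) z | true | true =
  inward-swap int int' (sym (diagonal-step (2 + r) (2 + c))) (inward-bounded n f _ (3 + r) (2 + c) int' z')
  where
  int' : Interior n (3 + r) (2 + c)
  int' = s≤s (s≤s z≤n) , s≤s (s≤s z≤n) , subst (_≤ n) (+-suc (2 + r) (2 + c)) sum≤n
  z' = ZeroBorder-resp (swap-interior G int' int) z
inward-bounded n (suc f) G 2 (suc (suc c)) (_ , _ , sum≤n) z | true | false =
  ⊥-elim (inward-blocked-by-zero-below (G 2 (2 + c))
           (proj₁ (z (2 + c) (s≤s z≤n) (≤-trans (m≤n+m _ 2) sum≤n))) d<ul guard)
inward-bounded n (suc f) G (suc (suc (suc r))) (suc (suc c)) int@(_ , _ , sum≤n) z | true | false =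
  inward-swap int int' refl (inward-bounded n f _ (2 + r) (2 + c) int' z')
  where
  int' : Interior n (2 + r) (2 + c)
  int' = s≤s (s≤s z≤n) , s≤s (s≤s z≤n) , ≤-trans (n≤1+n _) sum≤n
  z' = ZeroBorder-resp (swap-interior G int' int) z

outward-blocked-by-zero-below : ∀ {d} u → d ≡ zer → ((d <ᴱ u) ∧ not (isZer d)) ≡ true → ⊥
outward-blocked-by-zero-below u refl d<u with () ← trans (sym d<u) (∧-zeroʳ (zer <ᴱ u))

outward-blocked-by-inf-above : ∀ x d {u} → u ≡ inf →
  ((u <ᴱ x) ∨ ((d <ᴱ x) ∧ not (isZer d))) ≡ true → ((d <ᴱ u) ∧ not (isZer d)) ≡ false → ⊥
outward-blocked-by-inf-above x zer     refl guard _ with () ← trans (sym guard) (∧-zeroʳ (zer <ᴱ x))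
outward-blocked-by-inf-above x inf     refl () _
outward-blocked-by-inf-above x (key _) refl _ ()

outward-stop : ∀ {n r c} → Interior n r c → suc (r + c + c) ≤ n + n
outward-stop {n} {r} {c} (2≤r , _ , sum≤n) = begin
  suc (r + c + c) ≡⟨ sym (+-suc (r + c) c) ⟩
  r + c + suc c   ≤⟨ +-mono-≤ sum≤n (≤-trans (n≤1+n (suc c)) (≤-trans (+-monoˡ-≤ c 2≤r) sum≤n)) ⟩
  n + n           ∎
  where open ≤-Reasoning

outward-swap : ∀ {b} cost p {p'} → p' ≡ suc p → cost + p' ≤ b → suc cost + p ≤ b
outward-swap {b} cost p eq bound = subst (_≤ b) (trans (cong (cost +_) eq) (+-suc cost p)) bound

outward-bounded : ∀ n f G r c → Interior n r c → ZeroBorder n G → InfRim n G →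
                  proj₂ (outward f G r c) + (r + c + c) ≤ n + n
outward-bounded n f G 0 c (() , _) z ir
outward-bounded n f G 1 c (s≤s () , _) z ir
outward-bounded n f G (suc (suc r)) 0 (_ , () , _) z ir
outward-bounded n f G (suc (suc r)) 1 (_ , s≤s () , _) z ir
outward-bounded n zero G (suc (suc r)) (suc (suc c)) int z ir = ≤-trans (n≤1+n _) (outward-stop int)
outward-bounded n (suc f) G (suc (suc r)) (suc (suc c)) int@(_ , _ , sum≤n) z ir
  with (G (3 + r) (2 + c) <ᴱ G (2 + r) (2 + c)) ∨
       ((G (suc r) (3 + c) <ᴱ G (2 + r) (2 + c)) ∧ not (isZer (G (suc r) (3 + c)))) in guard
... | false = outward-stop int
... | true with (G (suc r) (3 + c) <ᴱ G (3 + r) (2 + c)) ∧ not (isZer (G (suc r) (3 + c))) in dr<u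
outward-bounded n (suc f) G 2 (suc (suc c)) (_ , _ , sum≤n) z ir | true | true =
  ⊥-elim (outward-blocked-by-zero-below (G 3 (2 + c))
           (proj₁ (z (3 + c) (s≤s z≤n) (≤-trans (n≤1+n _) sum≤n))) dr<u)
outward-bounded n (suc f) G (suc (suc (suc r))) (suc (suc c)) int@(_ , _ , sum≤n) z ir | true | true =
  outward-swap _ (3 + r + (2 + c) + (2 + c)) (diagonal-step (2 + r) (2 + c))
    (outward-bounded n f _ (2 + r) (3 + c) int' z' ir')
  where
  int' : Interior n (2 + r) (3 + c)
  int' = s≤s (s≤s z≤n) , s≤s (s≤s z≤n) , subst (_≤ n) (sym (+-suc (2 + r) (2 + c))) sum≤n
  agree = swap-interior G int' int
  z' = ZeroBorder-resp agree z
  ir' = InfRim-resp agree ir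
outward-bounded n (suc f) G (suc (suc r)) (suc (suc c)) int@(_ , _ , sum≤n) z ir | true | false
  with m≤n⇒m<n∨m≡n sum≤n
... | inj₂ on-rim = ⊥-elim (outward-blocked-by-inf-above (G (2 + r) (2 + c)) (G (suc r) (3 + c))
                      (ir (3 + r) (2 + c) (s≤s (s≤s z≤n)) (s≤s (s≤s z≤n)) (cong suc on-rim)) guard dr<u)
... | inj₁ below-rim =
  outward-swap _ (2 + r + (2 + c) + (2 + c)) refl (outward-bounded n f _ (3 + r) (2 + c) int' z' ir')
  where
  int' : Interior n (3 + r) (2 + c)
  int' = s≤s (s≤s z≤n) , s≤s (s≤s z≤n) , below-rim
  agree = swap-interior G int' int
  z' = ZeroBorder-resp agree z
  ir' = InfRim-resp agree ir

Confined : ℕ → Grid → Grid × ℕ → Set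
Confined n G (G' , cost) = (cost ≤ 2 * n) × AgreeOutside n G G'

n+n≡2*n : ∀ n → n + n ≡ 2 * n
n+n≡2*n n = cong (n +_) (sym (+-identityʳ n))

1≤2*n : ∀ {n r c} → Interior n r c → 1 ≤ 2 * n
1≤2*n (2≤r , _ , r+c≤n) =
  ≤-trans (≤-trans (s≤s z≤n) (≤-trans 2≤r (m≤m+n _ _))) (≤-trans r+c≤n (m≤m+n _ _))

inwardGuard : Grid → ℕ → ℕ → Bool
inwardGuard G r c = (G r c <ᴱ G (r ∸ 1) c) ∨ (G r c <ᴱ G (suc r) (c ∸ 1))

outwardGuard : Grid → ℕ → ℕ → Bool
outwardGuard G r c =
  (G (suc r) c <ᴱ G r c) ∨ ((G (r ∸ 1) (suc c) <ᴱ G r c) ∧ not (isZer (G (r ∸ 1) (suc c))))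

guarded-inward-confined : ∀ n f G r c b → Interior n r c → ZeroBorder n G →
                          Confined n G (if b then inward f G r c else (G , 1))
guarded-inward-confined n f G r c false int z = 1≤2*n int , AgreeOutside-refl
guarded-inward-confined n f G r c true int@(_ , _ , r+c≤n) z
  with inward-bounded n f G r c int z
... | cost+5≤ , agree = ≤-trans (m≤m+n _ 5) (≤-trans cost+5≤ r+c+c≤2*n) , agree
  where
  r+c+c≤2*n : r + c + c ≤ 2 * n
  r+c+c≤2*n = ≤-trans (+-mono-≤ r+c≤n (≤-trans (m≤n+m c r) r+c≤n)) (≤-reflexive (n+n≡2*n n))

guarded-outward-cost : ∀ n f G r c b → Interior n r c → ZeroBorder n G → InfRim n G →
                       (if b then proj₂ (outward f G r c) else 1) ≤ 2 * n
guarded-outward-cost n f G r c false int z ir = 1≤2*n int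
guarded-outward-cost n f G r c true int z ir =
  ≤-trans (m≤m+n _ _) (≤-trans (outward-bounded n f G r c int z ir) (≤-reflexive (n+n≡2*n n)))

SearchOutcome : ℕ → ℕ → Bool × (ℕ × ℕ) × ℕ → Set
SearchOutcome n r (found , (r' , c') , cost) = (cost ≤ r) × (found ≡ true → Interior n r' c')

search-step : ∀ {n r} res → SearchOutcome n r res →
              SearchOutcome n (suc r) (proj₁ res , proj₁ (proj₂ res) , suc (proj₂ (proj₂ res)))
search-step _ (cost≤r , found) = s≤s cost≤r , found

search-bounded : ∀ n f E K r c → 1 ≤ r → 2 ≤ c → r + c ≤ n → ZeroBorder n E →
                 SearchOutcome n r (search f E K r c)
search-bounded n zero E K r c _ _ _ _ = z≤n , λ ()
search-bounded n (suc f) E K 1 c _ 2≤c sum≤n z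
  with E 1 c | proj₁ (z c (≤-trans (s≤s z≤n) 2≤c) (≤-trans (n≤1+n c) sum≤n))
... | .zer | refl = s≤s z≤n , λ ()
search-bounded n (suc f) E K (suc (suc r)) c _ 2≤c sum≤n z with E (2 + r) c
... | zer   = s≤s z≤n , λ ()
... | inf   = search-step _ (search-bounded n f E K (suc r) c (s≤s z≤n) 2≤c (≤-trans (n≤1+n _) sum≤n) z)
... | key m with K ≡ᵇ m
...   | true  = s≤s z≤n , λ _ → s≤s (s≤s z≤n) , 2≤c , sum≤n
...   | false with m <ᵇ K
...     | true  = search-step _ (search-bounded n f E K (suc r) (suc c) (s≤s z≤n) (≤-trans 2≤c (n≤1+n c))
                                 (subst (_≤ n) (sym (+-suc (suc r) c)) sum≤n) z)
...     | false = search-step _ (search-bounded n f E K (suc r) c (s≤s z≤n) 2≤c (≤-trans (n≤1+n _) sum≤n) z)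

firstInf-range : ∀ E h i k {j} → firstInf E h i k ≡ just j → (2 + i ≤ j) × (j ≤ suc (i + k))
firstInf-range E h i (suc k) {j} eq with isInf (E (h + 1 ∸ i) (2 + i))
firstInf-range E h i (suc k) refl | true = ≤-refl , s≤s (subst (suc i ≤_) (sym (+-suc i k)) (s≤s (m≤m+n i k)))
... | false with firstInf-range E h (suc i) k eq
...   | 3+i≤j , j≤ = ≤-trans (n≤1+n _) 3+i≤j , subst (j ≤_) (cong suc (sym (+-suc i k))) j≤

lastKey-range : ∀ E h k {j} → lastKey E h k ≡ just j → (2 ≤ j) × (j ≤ suc k)
lastKey-range E h (suc k) eq with isKey (E (h + 2 ∸ suc k) (suc (suc k)))
lastKey-range E h (suc k) refl | true = s≤s (s≤s z≤n) , ≤-refl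
... | false with lastKey-range E h k eq
...   | 2≤j , j≤ = 2≤j , ≤-trans j≤ (n≤1+n _)

IsLDS⇒ZeroBorder : ∀ {L} → IsLDS L → ZeroBorder (height L + 3) (entry L)
IsLDS⇒ZeroBorder {L} lds k 1≤k k≤n =
  IsLDS.row1 lds k (≤-refl , 1≤k , 1+k≤h+4) ,
  IsLDS.col1 lds k (1≤k , ≤-refl , subst (_≤ height L + 4) (+-comm 1 k) 1+k≤h+4)
  where
  1+k≤h+4 : 1 + k ≤ height L + 4
  1+k≤h+4 = subst (suc k ≤_) (sym (+-suc (height L) 3)) (s≤s k≤n)

IsLDS⇒InfRim : ∀ {L} → IsLDS L → InfRim (height L + 3) (entry L)
IsLDS⇒InfRim {L} lds r c 2≤r 2≤c r+c≡ = IsLDS.diagInf lds r c (r+c≡h+4 , 2≤c , c≤h+2)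
  where
  h = height L
  r+c≡h+4 : r + c ≡ h + 4
  r+c≡h+4 = trans r+c≡ (sym (+-suc h 3))
  c≤h+2 : c ≤ h + 2
  c≤h+2 = +-cancelˡ-≤ 2 c (h + 2) (≤-trans (+-monoˡ-≤ c 2≤r)
            (≤-reflexive (trans r+c≡h+4 (trans (+-comm h 4) (cong (2 +_) (+-comm 2 h))))))

enlarge-ZeroBorder : ∀ {L} → IsLDS L → ZeroBorder (height L + 4) (enlarge (height L) (entry L))
enlarge-ZeroBorder {L} lds k 1≤k k≤h+4 = in-row1 , in-col1
  where
  h = height L
  old-border : k ≢ h + 4 → (entry L 1 k ≡ zer) × (entry L k 1 ≡ zer)
  old-border k≢h+4 = IsLDS⇒ZeroBorder lds k 1≤k
    (≤-pred (subst (suc k ≤_) (+-suc h 3) (≤∧≢⇒< k≤h+4 k≢h+4)))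
  in-row1 : enlarge h (entry L) 1 k ≡ zer
  in-row1 with suc k ≡ᵇ h + 5 in on-new-diagonal
  ... | true rewrite ∨-zeroʳ (k ≡ᵇ 1) = refl
  ... | false = proj₁ (old-border λ k≡ → ≡ᵇ-false⇒≢ _ _ on-new-diagonal
                  (trans (cong suc k≡) (sym (+-suc h 4))))
  in-col1 : enlarge h (entry L) k 1 ≡ zer
  in-col1 with k + 1 ≡ᵇ h + 5 in on-new-diagonal
  ... | true  = refl
  ... | false = proj₂ (old-border λ k≡ → ≡ᵇ-false⇒≢ _ _ on-new-diagonal
                  (trans (+-comm k 1) (trans (cong suc k≡) (sym (+-suc h 4)))))

diagonal-cell-interior : ∀ h j → 2 ≤ j → j ≤ suc h → Interior (h + 3) (h + 3 ∸ j) j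
diagonal-cell-interior h j 2≤j j≤1+h = 2≤row , 2≤j , ≤-reflexive (m∸n+n≡m j≤h+3)
  where
  2+j≤h+3 : 2 + j ≤ h + 3
  2+j≤h+3 = subst (2 + j ≤_) (+-comm 3 h) (s≤s (s≤s j≤1+h))
  j≤h+3 : j ≤ h + 3
  j≤h+3 = ≤-trans (m≤n+m j 2) 2+j≤h+3
  2≤row : 2 ≤ h + 3 ∸ j
  2≤row = m+n≤o⇒m≤o∸n 2 2+j≤h+3

search-in-LDS : ∀ {L} K → IsLDS L →
  SearchOutcome (height L + 3) (suc (height L)) (search (fuel (height L)) (entry L) K (suc (height L)) 2)
search-in-LDS {L} K lds = search-bounded (height L + 3) (fuel (height L)) (entry L) K (suc (height L)) 2
  (s≤s z≤n) ≤-refl (≤-reflexive (sym (+-suc (height L) 2))) (IsLDS⇒ZeroBorder lds)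

+-≤-* : ∀ {x y} k l B → x ≤ k * B → y ≤ l * B → x + y ≤ (k + l) * B
+-≤-* {x} {y} k l B x≤ y≤ = subst (x + y ≤_) (sym (*-distribʳ-+ B k l)) (+-mono-≤ x≤ y≤)

≤-1* : ∀ {x B} → x ≤ B → x ≤ 1 * B
≤-1* {x} {B} x≤B = subst (x ≤_) (sym (*-identityˡ B)) x≤B

1+h≤h+4 : ∀ h → suc h ≤ h + 4
1+h≤h+4 h = subst (suc h ≤_) (sym (+-suc h 3)) (s≤s (m≤m+n h 3))

h+5≤2*[h+4] : ∀ h → h + 5 ≤ 2 * (h + 4)
h+5≤2*[h+4] h = begin
  h + 5           ≡⟨ +-suc h 4 ⟩
  suc (h + 4)     ≡⟨ +-comm 1 (h + 4) ⟩
  h + 4 + 1       ≤⟨ +-monoʳ-≤ (h + 4) (≤-trans (s≤s z≤n) (m≤n+m 4 h)) ⟩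
  h + 4 + (h + 4) ≡⟨ n+n≡2*n (h + 4) ⟩
  2 * (h + 4)     ∎
  where open ≤-Reasoning

2*[h+3]≤2*[h+4] : ∀ h → 2 * (h + 3) ≤ 2 * (h + 4)
2*[h+3]≤2*[h+4] h = *-monoʳ-≤ 2 (+-monoʳ-≤ h (n≤1+n 3))

search-≤ : ∀ {s} h → s ≤ suc h → s ≤ 7 * (h + 4)
search-≤ h s≤1+h = ≤-trans s≤1+h (≤-trans (1+h≤h+4 h) (m≤n*m _ 7))

search-then-scan-≤ : ∀ {s} h → s ≤ suc h → s + (h + 4) ≤ 2 * (h + 4)
search-then-scan-≤ h s≤1+h = +-≤-* 1 1 (h + 4) (≤-1* (≤-trans s≤1+h (1+h≤h+4 h))) (≤-1* ≤-refl)

insertCost-≤ : ∀ {L} K → IsLDS L → insertCost L K ≤ 7 * (height L + 4)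
insertCost-≤ {L} K lds
  with search (fuel (height L)) (entry L) K (suc (height L)) 2 | search-in-LDS {L} K lds
... | true , _ , s | s≤1+h , _ = search-≤ (height L) s≤1+h
... | false , _ , s | s≤1+h , _ with firstInf (entry L) (height L) 0 (height L) in first-inf
...   | just j =
  ≤-trans (+-≤-* 2 2 B (search-then-scan-≤ h s≤1+h) (≤-trans (proj₁ inward-confined) (2*[h+3]≤2*[h+4] h)))
          (*-monoˡ-≤ B (m≤m+n 4 3))
  where
  h = height L
  B = h + 4
  range = firstInf-range (entry L) h 0 h first-inf
  int = diagonal-cell-interior h j (proj₁ range) (proj₂ range)
  inward-confined = guarded-inward-confined (h + 3) (fuel h) (set (entry L) (h + 3 ∸ j) j (key K)) (h + 3 ∸ j) j
                      true int (ZeroBorder-resp (set-interior (entry L) (key K) int) (IsLDS⇒ZeroBorder lds))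
...   | nothing =
  ≤-trans (+-≤-* 4 2 B (+-≤-* 2 2 B (search-then-scan-≤ h s≤1+h) (h+5≤2*[h+4] h)) (proj₁ inward-confined))
          (*-monoˡ-≤ B (m≤m+n 6 1))
  where
  h = height L
  B = h + 4
  int : Interior (h + 4) (h + 2) 2
  int = ≤-trans (s≤s (s≤s z≤n)) (m≤n+m 2 h) , s≤s (s≤s z≤n) , ≤-reflexive (+-assoc h 2 2)
  E′ = enlarge h (entry L)
  inward-confined = guarded-inward-confined (h + 4) (fuel (suc h)) (set E′ (h + 2) 2 (key K)) (h + 2) 2
                      true int (ZeroBorder-resp (set-interior E′ (key K) int) (enlarge-ZeroBorder lds))

deleteCost-≤ : ∀ {L} K → IsLDS L → deleteCost L K ≤ 7 * (height L + 4)
deleteCost-≤ {L} K lds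
  with search (fuel (height L)) (entry L) K (suc (height L)) 2 | search-in-LDS {L} K lds
... | false , _ , s | s≤1+h , _ = search-≤ (height L) s≤1+h
... | true , (r , c) , s | s≤1+h , found with lastKey (entry L) (height L) (height L) in last-key
...   | nothing = ≤-trans (search-then-scan-≤ (height L) s≤1+h) (*-monoˡ-≤ (height L + 4) (m≤m+n 2 5))
...   | just j with (r ≡ᵇ height L + 3 ∸ j) ∧ (c ≡ᵇ j)
...     | true = ≤-trans (+-≤-* 2 1 (height L + 4) (search-then-scan-≤ (height L) s≤1+h) (≤-1* ≤-refl))
                         (*-monoˡ-≤ (height L + 4) (m≤m+n 3 4))
...     | false =
  +-≤-* 6 1 B (+-≤-* 4 2 B (+-≤-* 2 2 B (search-then-scan-≤ h s≤1+h) inward-cost) outward-cost) (≤-1* ≤-refl)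
  where
  h = height L
  n = h + 3
  B = h + 4
  int = found refl
  range = lastKey-range (entry L) h h last-key
  -- F and G restate the grids deleteCost builds: after the refill, and after the guarded Inward.
  F = set (set (entry L) r c (entry L (h + 3 ∸ j) j)) (h + 3 ∸ j) j inf
  agreeF : AgreeOutside n (entry L) F
  agreeF = AgreeOutside-trans (set-interior (entry L) _ int)
                              (set-interior _ inf (diagonal-cell-interior h j (proj₁ range) (proj₂ range)))
  inward-confined = guarded-inward-confined n (fuel h) F r c (inwardGuard F r c) int
                      (ZeroBorder-resp agreeF (IsLDS⇒ZeroBorder lds))
  inward-cost = ≤-trans (proj₁ inward-confined) (2*[h+3]≤2*[h+4] h)
  G = proj₁ (if inwardGuard F r c then inward (fuel h) F r c else (F , 1))
  agreeG : AgreeOutside n (entry L) G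
  agreeG = AgreeOutside-trans agreeF (proj₂ inward-confined)
  outward-cost = ≤-trans (guarded-outward-cost n (fuel h) G r c (outwardGuard G r c) int
                            (ZeroBorder-resp agreeG (IsLDS⇒ZeroBorder lds))
                            (InfRim-resp agreeG (IsLDS⇒InfRim lds)))
                         (2*[h+3]≤2*[h+4] h)

monotone-by-steps : ∀ (f : ℕ → ℕ) → (∀ n → f n ≤ f (suc n)) → ∀ {m n} → m ≤ n → f m ≤ f n
monotone-by-steps f step m≤n = go (≤⇒≤′ m≤n)
  where
  go : ∀ {m n} → m ≤′ n → f m ≤ f n
  go ≤′-refl        = ≤-refl
  go (≤′-step m≤′n) = ≤-trans (go m≤′n) (step _)

countRow-mono : ∀ E r {m n} → m ≤ n → countRow E r m ≤ countRow E r n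
countRow-mono E r = monotone-by-steps (countRow E r) (λ n → m≤m+n _ _)

countRows-mono : ∀ E h {m n} → m ≤ n → countRows E h m ≤ countRows E h n
countRows-mono E h = monotone-by-steps (countRows E h) (λ n → m≤m+n _ _)

countRow-≥ : ∀ E r k → (∀ c → 2 ≤ c → c ≤ suc k → isKey (E r c) ≡ true) → k ≤ countRow E r (suc k)
countRow-≥ E r zero keys = z≤n
countRow-≥ E r (suc k) keys rewrite keys (2 + k) (s≤s (s≤s z≤n)) ≤-refl =
  subst (suc k ≤_) (+-comm 1 _) (s≤s (countRow-≥ E r k λ c 2≤c c≤ → keys c 2≤c (≤-trans c≤ (n≤1+n _))))

countRows-≥ : ∀ E h k w → (∀ r → 2 ≤ r → r ≤ suc k → w ≤ countRow E r (h + 4 ∸ r)) →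
              k * w ≤ countRows E h (suc k)
countRows-≥ E h zero w rows = z≤n
countRows-≥ E h (suc k) w rows =
  subst (_≤ countRows E h (2 + k)) (+-comm (k * w) w)
    (+-mono-≤ (countRows-≥ E h k w λ r 2≤r r≤ → rows r 2≤r (≤-trans r≤ (n≤1+n _)))
              (rows (2 + k) (s≤s (s≤s z≤n)) ≤-refl))

below-diagonal-isKey : ∀ {L} → IsLDS L → ∀ r c → 2 ≤ r → 2 ≤ c → r + c ≤ height L + 2 →
                       isKey (entry L r c) ≡ true
below-diagonal-isKey {L} lds r c 2≤r 2≤c r+c≤h+2
  with IsLDS.keys lds r c
         (≤-trans (s≤s z≤n) 2≤r , ≤-trans (s≤s z≤n) 2≤c , ≤-trans r+c≤h+2 (+-monoʳ-≤ h (m≤m+n 2 2)))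
         not-boundary not-rim not-tail
  where
  h = height L
  not-boundary : ¬ Boundary r c
  not-boundary (inj₁ refl) = <-irrefl refl 2≤r
  not-boundary (inj₂ refl) = <-irrefl refl 2≤c
  not-rim : ¬ InfDiag h r c
  not-rim (r+c≡h+4 , _) = <⇒≱ (+-monoʳ-< h (m<m+n 2 (s≤s z≤n))) (subst (_≤ h + 2) r+c≡h+4 r+c≤h+2)
  not-tail : ¬ InfTail h (IsLDS.m lds) r c
  not-tail (r+c≡h+3 , _) = <⇒≱ (+-monoʳ-< h (m<m+n 2 (s≤s z≤n))) (subst (_≤ h + 2) r+c≡h+3 r+c≤h+2)
... | _ , isKeyValue , _ rewrite isKeyValue = refl

⌊n/2⌋+⌊n/2⌋≤n : ∀ n → ⌊ n /2⌋ + ⌊ n /2⌋ ≤ n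
⌊n/2⌋+⌊n/2⌋≤n n = ≤-trans (+-monoʳ-≤ ⌊ n /2⌋ (⌊n/2⌋≤⌈n/2⌉ n)) (≤-reflexive (⌊n/2⌋+⌈n/2⌉≡n n))

n≤1+⌊n/2⌋+⌊n/2⌋ : ∀ n → n ≤ suc (⌊ n /2⌋ + ⌊ n /2⌋)
n≤1+⌊n/2⌋+⌊n/2⌋ zero          = z≤n
n≤1+⌊n/2⌋+⌊n/2⌋ (suc zero)    = s≤s z≤n
n≤1+⌊n/2⌋+⌊n/2⌋ (suc (suc n)) =
  s≤s (subst (suc n ≤_) (cong suc (sym (+-suc ⌊ n /2⌋ ⌊ n /2⌋))) (s≤s (n≤1+⌊n/2⌋+⌊n/2⌋ n)))

square-in-triangle : ∀ {h a r c} → a + a ≤ h → r ≤ suc a → c ≤ suc a → r + c ≤ h + 2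
square-in-triangle {h} {a} a+a≤h r≤ c≤ = begin
  _               ≤⟨ +-mono-≤ r≤ c≤ ⟩
  suc a + suc a   ≡⟨ cong suc (+-suc a a) ⟩
  2 + (a + a)     ≤⟨ +-monoʳ-≤ 2 a+a≤h ⟩
  2 + h           ≡⟨ +-comm 2 h ⟩
  h + 2           ∎
  where open ≤-Reasoning

numKeys-≥ : ∀ {L} → IsLDS L → ⌊ height L /2⌋ * ⌊ height L /2⌋ ≤ numKeys L
numKeys-≥ {L} lds =
  ≤-trans (countRows-≥ (entry L) h a a block-row) (countRows-mono (entry L) h 1+a≤h+3)
  where
  h = height L
  a = ⌊ h /2⌋
  a+a≤h = ⌊n/2⌋+⌊n/2⌋≤n h
  1+a≤h+3 : suc a ≤ h + 3
  1+a≤h+3 = ≤-trans (s≤s (⌊n/2⌋≤n h)) (subst (suc h ≤_) (+-comm 3 h) (≤-trans (n≤1+n _) (n≤1+n _)))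
  block-row : ∀ r → 2 ≤ r → r ≤ suc a → a ≤ countRow (entry L) r (h + 4 ∸ r)
  block-row r 2≤r r≤ =
    ≤-trans (countRow-≥ (entry L) r a λ c 2≤c c≤ →
               below-diagonal-isKey lds r c 2≤r 2≤c (square-in-triangle a+a≤h r≤ c≤))
            (countRow-mono (entry L) r (m+n≤o⇒m≤o∸n (suc a)
               (≤-trans (square-in-triangle a+a≤h ≤-refl r≤) (+-monoʳ-≤ h (m≤m+n 2 2)))))

h+4≤5*[1+⌊h/2⌋] : ∀ h → h + 4 ≤ 5 * suc ⌊ h /2⌋
h+4≤5*[1+⌊h/2⌋] h = begin
  h + 4                  ≤⟨ +-monoˡ-≤ 4 (n≤1+⌊n/2⌋+⌊n/2⌋ h) ⟩
  suc (a + a) + 4        ≤⟨ m≤m+n _ (3 * a) ⟩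
  suc (a + a) + 4 + 3 * a ≡⟨ expand a ⟩
  5 * suc a              ∎
  where
  open ≤-Reasoning
  a = ⌊ h /2⌋
  expand : ∀ a → suc (a + a) + 4 + 3 * a ≡ 5 * suc a
  expand = solve-∀

[1+n]²≤2*[1+n²] : ∀ n → suc n * suc n ≤ 2 * suc (n * n)
[1+n]²≤2*[1+n²] zero    = s≤s z≤n
[1+n]²≤2*[1+n²] (suc n) = ≤-trans (m≤m+n _ (n * n)) (≤-reflexive (expand n))
  where
  expand : ∀ n → suc (suc n) * suc (suc n) + n * n ≡ 2 * suc (suc n * suc n)
  expand = solve-∀

square-≤ : ∀ {x} k a N → x ≤ k * suc a → a * a ≤ N → x * x ≤ 2 * (k * k) * suc N
square-≤ {x} k a N x≤ a²≤N = begin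
  x * x                        ≤⟨ *-mono-≤ x≤ x≤ ⟩
  k * suc a * (k * suc a)      ≡⟨ regroup k (suc a) ⟩
  k * k * (suc a * suc a)      ≤⟨ *-monoʳ-≤ (k * k) ([1+n]²≤2*[1+n²] a) ⟩
  k * k * (2 * suc (a * a))    ≤⟨ *-monoʳ-≤ (k * k) (*-monoʳ-≤ 2 (s≤s a²≤N)) ⟩
  k * k * (2 * suc N)          ≡⟨ regroup′ (k * k) (suc N) ⟩
  2 * (k * k) * suc N          ∎
  where
  open ≤-Reasoning
  regroup : ∀ k b → k * b * (k * b) ≡ k * k * (b * b)
  regroup = solve-∀
  regroup′ : ∀ m b → m * (2 * b) ≡ 2 * m * b
  regroup′ = solve-∀

cost-≤ : ∀ {x} h → x ≤ 7 * (h + 4) → x ≤ 35 * suc ⌊ h /2⌋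
cost-≤ h x≤ =
  ≤-trans x≤ (≤-trans (*-monoʳ-≤ 7 (h+4≤5*[1+⌊h/2⌋] h)) (≤-reflexive (sym (*-assoc 7 5 (suc ⌊ h /2⌋)))))

corollary2 : ∃[ c ] ((L : Lattice) → IsLDS L → (K : ℕ) → 0 < K →
    (insertCost L K * insertCost L K ≤ c * suc (numKeys L))
    × (deleteCost L K * deleteCost L K ≤ c * suc (numKeys L)))
corollary2 = 2 * (35 * 35) , λ L lds K _ →
  square-≤ 35 _ _ (cost-≤ (height L) (insertCost-≤ K lds)) (numKeys-≥ lds) ,
  square-≤ 35 _ _ (cost-≤ (height L) (deleteCost-≤ K lds)) (numKeys-≥ lds)
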